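{- Fix $n\ge 6$. Any two strong bicentral $2$-trees on $n$ vertices with tail set $\{2,3\}$ having exactly two tail vertices of degree $3$ are isomorphic; that is, such a graph is unique up to isomorphism.
   Context: A $2$-tree is a graph obtained from the triangle $K_3$ by repeatedly adding a new vertex adjacent to both endpoints of an existing edge. For $r\in\{1,2,3\}$ and an integer $\Delta\ge 2$, a $2$-tree on $n$ vertices is $r$-central with maximum degree $\Delta$ if $\Delta$ is its maximum degree and exactly $r$ vertices have degree $\Delta$; these $r$ vertices form the core and the other $n-r$ vertices form the tail. It is strong if the core induces $K_r$. It has tail set $\{2,3\}$ if every tail vertex has degree $2$ or $3$. "Bicentral" means $2$-central. -}

module Defs where

open import Data.Nat using (ℕ; zero; suc; _≤_; _+_)
open import Data.Fin using (Fin; punchIn)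
open import Data.Fin.Properties using (_≟_)
open import Data.Bool using (Bool; true; false; if_then_else_)
open import Data.List using (List; map; length; filter)
open import Data.Nat.ListAction using (sum)
open import Data.List using () renaming (allFin to allFinL)
open import Data.Product using (Σ; _×_; _,_; ∃)
open import Data.Sum using (_⊎_)
open import Relation.Binary.PropositionalEquality using (_≡_; _≢_)
open import Relation.Nullary using (¬_; Dec)
open import Relation.Nullary.Decidable using (¬?)
open import Function.Bundles using (_↔_; Inverse)
import Data.Nat as ℕ

record Graph (n : ℕ) : Set where
  field
    adj   : Fin n → Fin n → Bool
    sym   : ∀ i j → adj i j ≡ adj j i
    irrfl : ∀ i → adj i i ≡ false
open Graph public

deleteVertex : ∀ {n} → Graph (suc n) → Fin (suc n) → Graph n
deleteVertex G w = record
  { adj   = λ i j → adj G (punchIn w i) (punchIn w j)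
  ; sym   = λ i j → sym G (punchIn w i) (punchIn w j)
  ; irrfl = λ i → irrfl G (punchIn w i) }

IsTriangle : Graph 3 → Set
IsTriangle G = ∀ i j → i ≢ j → adj G i j ≡ true

-- 2-trees: obtained from K₃ by repeatedly adding a new vertex adjacent to
-- exactly the two endpoints of an existing edge. Vertex labels are
-- arbitrary: the last-added vertex can be any w.
data IsTwoTree : {n : ℕ} → Graph n → Set where
  base : (G : Graph 3) → IsTriangle G → IsTwoTree G
  step : ∀ {n} (G : Graph (suc n)) (w : Fin (suc n)) (u v : Fin n) →
         IsTwoTree (deleteVertex G w) →
         adj (deleteVertex G w) u v ≡ true →
         (∀ x → adj G w (punchIn w x) ≡ true → x ≡ u ⊎ x ≡ v) →
         adj G w (punchIn w u) ≡ true →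
         adj G w (punchIn w v) ≡ true →
         IsTwoTree G

deg : ∀ {n} → Graph n → Fin n → ℕ
deg {n} G i = sum (map (λ j → if adj G i j then 1 else 0) (allFinL n))

countV : ∀ {n} {P : Fin n → Set} → (∀ i → Dec (P i)) → ℕ
countV {n} P? = length (filter P? (allFinL n))

IsMaxDegree : ∀ {n} → Graph n → ℕ → Set
IsMaxDegree G Δ = (∀ i → deg G i ≤ Δ) × ∃ λ i → deg G i ≡ Δ

InCore : ∀ {n} → Graph n → ℕ → Fin n → Set
InCore G Δ i = deg G i ≡ Δ

IsCentral : ∀ {n} → ℕ → Graph n → ℕ → Set
IsCentral r G Δ = 2 ≤ Δ × IsMaxDegree G Δ ×
                  countV (λ i → deg G i ℕ.≟ Δ) ≡ r

IsStrong : ∀ {n} → Graph n → ℕ → Set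
IsStrong G Δ = ∀ i j → InCore G Δ i → InCore G Δ j → i ≢ j → adj G i j ≡ true

TailSet23 : ∀ {n} → Graph n → ℕ → Set
TailSet23 G Δ = ∀ i → ¬ InCore G Δ i → deg G i ≡ 2 ⊎ deg G i ≡ 3

tail3Count : ∀ {n} → Graph n → ℕ → ℕ
tail3Count G Δ = countV (λ i → ¬? (deg G i ℕ.≟ Δ) Relation.Nullary.×-dec (deg G i ℕ.≟ 3))
  where import Relation.Nullary

IsGoodGraph : ∀ {n} → Graph n → Set
IsGoodGraph G = IsTwoTree G × Σ ℕ λ Δ →
  IsCentral 2 G Δ × IsStrong G Δ × TailSet23 G Δ × tail3Count G Δ ≡ 2

Isomorphic : ∀ {n} → Graph n → Graph n → Set
Isomorphic {n} G H = Σ (Fin n ↔ Fin n) λ f →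
  ∀ i j → adj H (Inverse.to f i) (Inverse.to f j) ≡ adj G i j

{-# OPTIONS --safe #-}
module Submission where

-- In a 2-tree on n vertices the degrees sum to 4n − 6, since every added vertex contributes 4. In a
-- good graph the degrees are Δ on the two core vertices u and v, 3 on two tail vertices and 2
-- elsewhere, which sum to 2n + 2(Δ − 2) + 2; hence Δ = n − 2, and u and v each miss exactly one
-- other vertex, x and y. A tail vertex adjacent to u, v and a third vertex has degree 3, and the
-- two neighbours of a degree-2 vertex of a 2-tree are adjacent. With these facts, x = y and x ~ y
-- each lead to a third tail vertex of degree 3, a tail vertex of degree 4, or an edge u x or v y.
-- So x ≠ y are non-adjacent, their further neighbours p and q are the two tail vertices of degree
-- 3, and every other vertex is adjacent to exactly u and v. The adjacency of a good graph is
-- therefore a fixed pattern on the distinguished vertices u, v, x, y, p, q and the rest, and any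
-- permutation matching the distinguished vertices of two good graphs is an isomorphism.

open import Data.Bool using (Bool; true; false; if_then_else_)
open import Data.Bool.Properties using (¬-not) renaming (_≟_ to _≟ᵇ_)
open import Data.Empty using (⊥; ⊥-elim)
open import Data.Fin using (Fin; zero; suc; punchIn; inject₁; fromℕ)
open import Data.Fin.Patterns using (0F; 1F; 2F; 3F; 4F; 5F)
open import Data.Fin.Permutation as Perm using (Permutation′; _⟨$⟩ʳ_)
open import Data.Fin.Properties
  using (_≟_; any?; punchIn-punchOut; punchInᵢ≢i; punchIn-injective; suc-injective; 0≢1+n)
open import Data.List using (List; []; _∷_; [_]; length; filter; map; tabulate; allFin)
open import Data.List.Membership.Propositional using (_∈_; _∉_; find; lose)
open import Data.List.Membership.Propositional.Properties using (∈-filter⁺; ∈-filter⁻; ∈-allFin)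
open import Data.List.Properties using (map-tabulate; filter-notAll; length-tabulate)
open import Data.List.Relation.Binary.Subset.Propositional using (_⊆_)
open import Data.List.Relation.Unary.All as All using (All; []; _∷_)
open import Data.List.Relation.Unary.All.Properties using (¬Any⇒All¬; All¬⇒¬Any)
open import Data.List.Relation.Unary.AllPairs using ([]; _∷_)
open import Data.List.Relation.Unary.Any as Any using (here; there)
open import Data.List.Relation.Unary.Unique.Propositional using (Unique)
open import Data.List.Relation.Unary.Unique.Propositional.Properties using (allFin⁺; filter⁺)
open import Data.Maybe using (Maybe; just; nothing; maybe)
open import Data.Nat using (ℕ; zero; suc; _+_; _*_; _∸_; _≤_; _<_; z≤n; s≤s)
import Data.Nat as ℕ
open import Data.Nat.ListAction using () renaming (sum to sumˡ)
open import Data.Nat.Properties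
  using (+-0-commutativeMonoid; +-*-semiring; +-suc; +-comm; +-assoc; +-identityʳ; *-identityʳ; *-zeroʳ;
         *-suc; +-cancelˡ-≡; *-cancelʳ-≡; m+[n∸m]≡n; ≤-antisym; ≤-reflexive; ≤-trans; <⇒≱)
open import Data.Nat.Tactic.RingSolver using (solve-∀)
open import Algebra.Properties.CommutativeMonoid.Sum +-0-commutativeMonoid
  using (sum; sum-cong-≗; sum-remove; ∑-distrib-+)
open import Algebra.Properties.Semiring.Sum +-*-semiring using (*-distribˡ-sum)
open import Data.Product using (Σ; ∃; ∃₂; _×_; _,_; proj₁; proj₂)
open import Data.Sum using (_⊎_; inj₁; inj₂; [_,_]′; swap)
import Data.Sum as Sum
open import Data.Vec as Vec using (Vec; []; _∷_)
open import Data.Vec.Relation.Unary.All using ([]; _∷_)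
open import Data.Vec.Relation.Unary.AllPairs using ([]; _∷_)
open import Data.Vec.Relation.Unary.Unique.Propositional using () renaming (Unique to VecUnique)
open import Data.Vec.Relation.Unary.Unique.Propositional.Properties using (lookup-injective)
open import Function using (_∘_; id; case_of_)
open import Function.Bundles using (Injection)
open import Function.Definitions using (Injective)
open import Function.Properties.Inverse using (↔⇒↣)
open import Relation.Binary.Definitions using (DecidableEquality)
open import Relation.Binary.PropositionalEquality
  using (_≡_; _≢_; refl; sym; trans; cong; cong₂; subst; module ≡-Reasoning)
open import Relation.Nullary using (¬_; Dec; yes; no; does; contradiction)
open import Relation.Nullary.Decidable using (¬?; _×-dec_; decidable-stable; dec-true; dec-false)
open import Relation.Unary using (Decidable)

open import Defs renaming (sym to adj-sym)

-- Counting

unique-⊆⇒length≤ : ∀ {A : Set} → DecidableEquality A →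
  ∀ {xs ys : List A} → Unique xs → xs ⊆ ys → length xs ≤ length ys
unique-⊆⇒length≤ _≟ᴬ_ [] _ = z≤n
unique-⊆⇒length≤ _≟ᴬ_ {x ∷ xs} {ys} (x∉xs ∷ uxs) xs⊆ys = ≤-trans
  (s≤s (unique-⊆⇒length≤ _≟ᴬ_ uxs xs⊆ys-x))
  (filter-notAll (¬? ∘ (x ≟ᴬ_)) ys (Any.map (λ x≡y x≢y → x≢y x≡y) (xs⊆ys (here refl))))
  where
  xs⊆ys-x : xs ⊆ filter (¬? ∘ (x ≟ᴬ_)) ys
  xs⊆ys-x z∈xs = ∈-filter⁺ (¬? ∘ (x ≟ᴬ_)) (xs⊆ys (there z∈xs)) (All.lookup x∉xs z∈xs)

∈-pair : ∀ {A : Set} {a b z : A} → z ∈ a ∷ b ∷ [] → z ≡ a ⊎ z ≡ b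
∈-pair (here z≡a)         = inj₁ z≡a
∈-pair (there (here z≡b)) = inj₂ z≡b

pair-covered : ∀ {A : Set} {a b p q z : A} → p ≢ q →
  p ≡ a ⊎ p ≡ b → q ≡ a ⊎ q ≡ b → z ≡ a ⊎ z ≡ b → z ≡ p ⊎ z ≡ q
pair-covered p≢q (inj₁ refl) (inj₁ refl) _  = contradiction refl p≢q
pair-covered p≢q (inj₂ refl) (inj₂ refl) _  = contradiction refl p≢q
pair-covered _   (inj₁ refl) (inj₂ refl) z∈ = z∈
pair-covered _   (inj₂ refl) (inj₁ refl) z∈ = swap z∈

bit : Bool → ℕ
bit b = if b then 1 else 0

sum-map-allFin : ∀ {n} (f : Fin n → ℕ) → sumˡ (map f (allFin n)) ≡ sum f
sum-map-allFin f = trans (cong sumˡ (map-tabulate id f)) (sum-tabulate f)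
  where
  sum-tabulate : ∀ {m} (g : Fin m → ℕ) → sumˡ (tabulate g) ≡ sum g
  sum-tabulate {zero}  g = refl
  sum-tabulate {suc m} g = cong (g zero +_) (sum-tabulate (g ∘ suc))

sum-const : ∀ n c → sum {n} (λ _ → c) ≡ n * c
sum-const zero    c = refl
sum-const (suc n) c = cong (c +_) (sum-const n c)

module _ {n : ℕ} {P : Fin n → Set} (P? : Decidable P) where

  open import Data.List.Membership.DecPropositional (_≟_ {n}) using (_∈?_)

  countV≡sum : countV P? ≡ sum (λ i → bit (does (P? i)))
  countV≡sum = trans (length-filter (allFin n)) (sum-map-allFin (λ i → bit (does (P? i))))
    where
    length-filter : ∀ xs → length (filter P? xs) ≡ sumˡ (map (λ i → bit (does (P? i))) xs)
    length-filter []       = refl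
    length-filter (x ∷ xs) with P? x
    ... | yes _ = cong suc (length-filter xs)
    ... | no _  = length-filter xs

  countV-complement : countV P? + countV (¬? ∘ P?) ≡ n
  countV-complement = trans (split (allFin n)) (length-tabulate id)
    where
    split : ∀ xs → length (filter P? xs) + length (filter (¬? ∘ P?) xs) ≡ length xs
    split []       = refl
    split (x ∷ xs) with P? x
    ... | yes _ = cong suc (split xs)
    ... | no _  = trans (+-suc _ _) (cong suc (split xs))

  private
    satisfying : List (Fin n)
    satisfying = filter P? (allFin n)

    ∈-satisfying : ∀ {i} → P i → i ∈ satisfying
    ∈-satisfying = ∈-filter⁺ P? (∈-allFin _)

    satisfying-sound : ∀ {i} → i ∈ satisfying → P i
    satisfying-sound i∈ = proj₂ (∈-filter⁻ P? {xs = allFin n} i∈)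

  length≤countV : ∀ {ys} → Unique ys → All P ys → length ys ≤ countV P?
  length≤countV uys Pys = unique-⊆⇒length≤ _≟_ uys (∈-satisfying ∘ All.lookup Pys)

  countV≤length : ∀ {ys} → (∀ {i} → P i → i ∈ ys) → countV P? ≤ length ys
  countV≤length P⊆ys =
    unique-⊆⇒length≤ _≟_ (filter⁺ P? (allFin⁺ n)) (P⊆ys ∘ satisfying-sound)

  length<countV⇒∃∉ : ∀ ws → length ws < countV P? → ∃ λ i → P i × i ∉ ws
  length<countV⇒∃∉ ws ws<count with Any.any? (λ i → ¬? (i ∈? ws)) satisfying
  ... | yes some = let i , i∈ , i∉ = find some in i , satisfying-sound i∈ , i∉
  ... | no none  = contradiction (countV≤length covered) (<⇒≱ ws<count)
    where
    covered : ∀ {i} → P i → i ∈ ws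
    covered Pi = decidable-stable (_ ∈? ws) (none ∘ lose (∈-satisfying Pi))

  countV≤length⇒∈ : ∀ {ys i} → Unique ys → All P ys → countV P? ≤ length ys →
                    P i → i ∈ ys
  countV≤length⇒∈ {ys} {i} uys Pys count≤ Pi with i ∈? ys
  ... | yes i∈ys = i∈ys
  ... | no i∉ys  =
    contradiction (length≤countV (¬Any⇒All¬ ys i∉ys ∷ uys) (Pi ∷ Pys)) (<⇒≱ (s≤s count≤))

  countV≡2⇒pair : countV P? ≡ 2 →
    ∃₂ λ s t → s ≢ t × P s × P t × (∀ {i} → P i → i ≡ s ⊎ i ≡ t)
  countV≡2⇒pair count≡2
    with s , Ps , _     ← length<countV⇒∃∉ [] (subst (0 <_) (sym count≡2) (s≤s z≤n))
    with t , Pt , t∉[s] ← length<countV⇒∃∉ [ s ] (subst (1 <_) (sym count≡2) (s≤s (s≤s z≤n)))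
    = s , t , s≢t , Ps , Pt , ∈-pair ∘ countV≤length⇒∈ distinct (Ps ∷ Pt ∷ []) count≤2
    where
    s≢t : s ≢ t
    s≢t s≡t = t∉[s] (here (sym s≡t))
    distinct : Unique (s ∷ t ∷ [])
    distinct = (s≢t ∷ []) ∷ [] ∷ []
    count≤2 : countV P? ≤ 2
    count≤2 = ≤-reflexive count≡2

-- Degrees

module _ {n : ℕ} (G : Graph n) where

  neighbour? : ∀ i → Decidable (λ j → adj G i j ≡ true)
  neighbour? i j = adj G i j ≟ᵇ true

  deg≡sum : ∀ i → deg G i ≡ sum (λ j → bit (adj G i j))
  deg≡sum i = sum-map-allFin (λ j → bit (adj G i j))

  deg≡countV : ∀ i → deg G i ≡ countV (neighbour? i)
  deg≡countV i =
    trans (deg≡sum i) (trans (sum-cong-≗ (bit-does ∘ adj G i)) (sym (countV≡sum (neighbour? i))))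
    where
    bit-does : ∀ b → bit b ≡ bit (does (b ≟ᵇ true))
    bit-does true  = refl
    bit-does false = refl

  adj-flip : ∀ {i j b} → adj G i j ≡ b → adj G j i ≡ b
  adj-flip {i} {j} = trans (adj-sym G j i)

  adjacent⇒≢ : ∀ {i j} → adj G i j ≡ true → i ≢ j
  adjacent⇒≢ {i} i~j refl = contradiction (trans (sym i~j) (irrfl G i)) λ ()

  neighbour≢non-neighbour : ∀ {i j k} → adj G i j ≡ true → adj G i k ≡ false → j ≢ k
  neighbour≢non-neighbour i~j i≁k refl = contradiction (trans (sym i~j) i≁k) λ ()

  module _ {i : Fin n} where

    length≤deg : ∀ {ys} → Unique ys → All (λ j → adj G i j ≡ true) ys → length ys ≤ deg G i
    length≤deg uys i~ys = subst (_ ≤_) (sym (deg≡countV i)) (length≤countV (neighbour? i) uys i~ys)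

    deg≤length : ∀ {ys} → (∀ {j} → adj G i j ≡ true → j ∈ ys) → deg G i ≤ length ys
    deg≤length N⊆ys = subst (_≤ _) (sym (deg≡countV i)) (countV≤length (neighbour? i) N⊆ys)

    length<deg⇒∃neighbour∉ : ∀ ws → length ws < deg G i →
                             ∃ λ j → adj G i j ≡ true × j ∉ ws
    length<deg⇒∃neighbour∉ ws ws<deg =
      length<countV⇒∃∉ (neighbour? i) ws (subst (_ <_) (deg≡countV i) ws<deg)

    deg≤length⇒neighbour∈ : ∀ {ys j} → Unique ys → All (λ k → adj G i k ≡ true) ys →
                            deg G i ≤ length ys → adj G i j ≡ true → j ∈ ys
    deg≤length⇒neighbour∈ uys i~ys deg≤ =
      countV≤length⇒∈ (neighbour? i) uys i~ys (subst (_≤ _) (deg≡countV i) deg≤)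

    deg≡2⇒neighbour∈ : ∀ {s t r} → deg G i ≡ 2 → s ≢ t →
                       adj G i s ≡ true → adj G i t ≡ true →
                       adj G i r ≡ true → r ∈ s ∷ t ∷ []
    deg≡2⇒neighbour∈ deg≡2 s≢t i~s i~t =
      deg≤length⇒neighbour∈ ((s≢t ∷ []) ∷ [] ∷ []) (i~s ∷ i~t ∷ []) (≤-reflexive deg≡2)

    outside⇒non-adjacent : ∀ {ys j} → (∀ {r} → adj G i r ≡ true → r ∈ ys) →
                           All (j ≢_) ys → adj G i j ≡ false
    outside⇒non-adjacent N⊆ys j∉ys = ¬-not (All¬⇒¬Any j∉ys ∘ N⊆ys)

  SoleNonNeighbour : Fin n → Fin n → Set
  SoleNonNeighbour w x =
    x ≢ w × adj G w x ≡ false × (∀ j → j ≢ w → j ≢ x → adj G w j ≡ true)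

  non-neighbour-count : ∀ w → deg G w + 2 ≡ n → countV (¬? ∘ neighbour? w) ≡ 2
  non-neighbour-count w deg+2≡n = +-cancelˡ-≡ (deg G w) _ _ (begin
    deg G w + non                 ≡⟨ cong (_+ non) (deg≡countV w) ⟩
    countV (neighbour? w) + non   ≡⟨ countV-complement (neighbour? w) ⟩
    n                             ≡⟨ deg+2≡n ⟨
    deg G w + 2                   ∎)
    where
    open ≡-Reasoning
    non : ℕ
    non = countV (¬? ∘ neighbour? w)

  sole-non-neighbour : ∀ {w} x → x ≢ w → ¬ adj G w x ≡ true →
    (∀ {j} → ¬ adj G w j ≡ true → j ≡ w ⊎ j ≡ x) → SoleNonNeighbour w x
  sole-non-neighbour {w} x x≢w w≁x only =
    x≢w , ¬-not w≁x ,
    λ j j≢w j≢x → decidable-stable (neighbour? w j) ([ j≢w , j≢x ]′ ∘ only)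

  non-neighbour-unique : ∀ w → deg G w + 2 ≡ n → ∃ (SoleNonNeighbour w)
  non-neighbour-unique w deg+2≡n
    with s , t , s≢t , w≁s , w≁t , only
           ← countV≡2⇒pair (¬? ∘ neighbour? w) (non-neighbour-count w deg+2≡n)
    with only {w} (λ w~w → adjacent⇒≢ w~w refl)
  ... | inj₁ refl = t , sole-non-neighbour t (s≢t ∘ sym) w≁t only
  ... | inj₂ refl = s , sole-non-neighbour s s≢t w≁s (swap ∘ only)

module _ {n : ℕ} (G : Graph (suc n)) (w : Fin (suc n)) where

  private
    G-w = deleteVertex G w

  deg-punchIn : ∀ i → deg G (punchIn w i) ≡ deg G-w i + bit (adj G (punchIn w i) w)
  deg-punchIn i = begin
    deg G (punchIn w i)                   ≡⟨ deg≡sum G (punchIn w i) ⟩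
    sum row                               ≡⟨ sum-remove row ⟩
    to-w + sum (λ j → bit (adj G-w i j))  ≡⟨ +-comm to-w _ ⟩
    sum (λ j → bit (adj G-w i j)) + to-w  ≡⟨ cong (_+ to-w) (deg≡sum G-w i) ⟨
    deg G-w i + to-w                      ∎
    where
    open ≡-Reasoning
    row : Fin (suc n) → ℕ
    row j = bit (adj G (punchIn w i) j)
    to-w : ℕ
    to-w = row w

  degreeSum-deleteVertex : sum (deg G) ≡ 2 * deg G w + sum (deg G-w)
  degreeSum-deleteVertex = begin
    sum (deg G)                               ≡⟨ sum-remove (deg G) ⟩
    deg G w + sum (deg G ∘ punchIn w)         ≡⟨ cong (deg G w +_) (sum-cong-≗ deg-punchIn) ⟩
    deg G w + sum (λ i → deg G-w i + to-w i)  ≡⟨ cong (deg G w +_) (∑-distrib-+ (deg G-w) to-w) ⟩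
    deg G w + (sum (deg G-w) + sum to-w)      ≡⟨ cong ((deg G w +_) ∘ (sum (deg G-w) +_)) edges-at-w ⟩
    deg G w + (sum (deg G-w) + deg G w)       ≡⟨ rearrange (deg G w) (sum (deg G-w)) ⟩
    2 * deg G w + sum (deg G-w)               ∎
    where
    open ≡-Reasoning
    to-w : Fin n → ℕ
    to-w i = bit (adj G (punchIn w i) w)
    from-w : Fin (suc n) → ℕ
    from-w j = bit (adj G w j)
    rearrange : ∀ d s → d + (s + d) ≡ 2 * d + s
    rearrange = solve-∀
    edges-at-w : sum to-w ≡ deg G w
    edges-at-w = begin
      sum to-w                       ≡⟨ sum-cong-≗ (cong bit ∘ λ i → adj-sym G (punchIn w i) w) ⟩
      sum from-w′                    ≡⟨ cong ((_+ sum from-w′) ∘ bit) (irrfl G w) ⟨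
      from-w w + sum from-w′         ≡⟨ sum-remove from-w ⟨
      sum from-w                     ≡⟨ deg≡sum G w ⟨
      deg G w                        ∎
      where
      from-w′ : Fin n → ℕ
      from-w′ = from-w ∘ punchIn w

-- 2-trees

data PunchView {n : ℕ} (w : Fin (suc n)) : Fin (suc n) → Set where
  at      : PunchView w w
  punched : ∀ i → PunchView w (punchIn w i)

punchView : ∀ {n} (w j : Fin (suc n)) → PunchView w j
punchView w j with j ≟ w
... | yes refl = at
... | no j≢w   = subst (PunchView w) (punchIn-punchOut (j≢w ∘ sym)) (punched _)

twoTree-minDegree : ∀ {n} {G : Graph n} → IsTwoTree G →
  ∀ z → ∃₂ λ s t → s ≢ t × adj G z s ≡ true × adj G z t ≡ true
twoTree-minDegree (base G K₃) 0F = 1F , 2F , (λ ()) , K₃ _ _ (λ ()) , K₃ _ _ (λ ())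
twoTree-minDegree (base G K₃) 1F = 0F , 2F , (λ ()) , K₃ _ _ (λ ()) , K₃ _ _ (λ ())
twoTree-minDegree (base G K₃) 2F = 0F , 1F , (λ ()) , K₃ _ _ (λ ()) , K₃ _ _ (λ ())
twoTree-minDegree (step G w u v T u~v _ w~u w~v) z with punchView w z
... | at =
  punchIn w u , punchIn w v , adjacent⇒≢ (deleteVertex G w) u~v ∘ punchIn-injective w u v , w~u , w~v
... | punched z′ with s , t , s≢t , z~s , z~t ← twoTree-minDegree T z′ =
  punchIn w s , punchIn w t , s≢t ∘ punchIn-injective w s t , z~s , z~t

twoTree-deg≥2 : ∀ {n} {G : Graph n} → IsTwoTree G → ∀ z → 2 ≤ deg G z
twoTree-deg≥2 {G = G} T z with s , t , s≢t , z~s , z~t ← twoTree-minDegree T z =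
  length≤deg G ((s≢t ∷ []) ∷ [] ∷ []) (z~s ∷ z~t ∷ [])

twoTree-no-pendant : ∀ {n} {G : Graph n} → IsTwoTree G →
  ∀ z t → ¬ (∀ r → adj G z r ≡ true → r ≡ t)
twoTree-no-pendant T z t only with s , s′ , s≢s′ , z~s , z~s′ ← twoTree-minDegree T z =
  s≢s′ (trans (only s z~s) (sym (only s′ z~s′)))

-- Stated with the neighbourhood of z rather than its degree, which deleting a vertex can change.
twoTree-link : ∀ {n} {G : Graph n} → IsTwoTree G → ∀ {z s t} → s ≢ t →
  adj G z s ≡ true → adj G z t ≡ true → (∀ r → adj G z r ≡ true → r ≡ s ⊎ r ≡ t) →
  adj G s t ≡ true
twoTree-link (base G K₃) s≢t _ _ _ = K₃ _ _ s≢t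
twoTree-link (step G w u v T u~v only w~u w~v) {z} {s} {t} s≢t z~s z~t z-only
  with punchView w z | punchView w s | punchView w t
... | _  | at | at = contradiction refl s≢t
... | at | at | _  = ⊥-elim (adjacent⇒≢ G z~s refl)
... | at | _  | at = ⊥-elim (adjacent⇒≢ G z~t refl)
... | at | punched s′ | punched t′ with only s′ z~s | only t′ z~t
...   | inj₁ refl | inj₁ refl = contradiction refl s≢t
...   | inj₁ refl | inj₂ refl = u~v
...   | inj₂ refl | inj₁ refl = adj-flip G u~v
...   | inj₂ refl | inj₂ refl = contradiction refl s≢t
twoTree-link (step G w u v T u~v only w~u w~v) {z} {s} {t} s≢t z~s z~t z-only
  | punched z′ | at | punched t′ = contradiction
    (λ r z~r → [ ⊥-elim ∘ punchInᵢ≢i w r , punchIn-injective w r t′ ]′ (z-only _ z~r))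
    (twoTree-no-pendant T z′ t′)
twoTree-link (step G w u v T u~v only w~u w~v) {z} {s} {t} s≢t z~s z~t z-only
  | punched z′ | punched s′ | at = contradiction
    (λ r z~r → [ punchIn-injective w r s′ , ⊥-elim ∘ punchInᵢ≢i w r ]′ (z-only _ z~r))
    (twoTree-no-pendant T z′ s′)
twoTree-link (step G w u v T u~v only w~u w~v) {z} {s} {t} s≢t z~s z~t z-only
  | punched z′ | punched s′ | punched t′ =
    twoTree-link T (s≢t ∘ cong (punchIn w)) z~s z~t
      (λ r z~r → Sum.map (punchIn-injective w r s′) (punchIn-injective w r t′) (z-only _ z~r))

twoTree-deg≡2⇒link : ∀ {n} {G : Graph n} → IsTwoTree G → ∀ {z s t} → deg G z ≡ 2 →
  s ≢ t → adj G z s ≡ true → adj G z t ≡ true → adj G s t ≡ true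
twoTree-deg≡2⇒link {G = G} T deg≡2 s≢t z~s z~t =
  twoTree-link T s≢t z~s z~t λ r → ∈-pair ∘ deg≡2⇒neighbour∈ G deg≡2 s≢t z~s z~t

triangle-deg : ∀ {G : Graph 3} → IsTriangle G → ∀ i → deg G i ≡ 2
triangle-deg {G} K₃ 0F rewrite irrfl G 0F | K₃ 0F 1F (λ ()) | K₃ 0F 2F (λ ()) = refl
triangle-deg {G} K₃ 1F rewrite irrfl G 1F | K₃ 1F 0F (λ ()) | K₃ 1F 2F (λ ()) = refl
triangle-deg {G} K₃ 2F rewrite irrfl G 2F | K₃ 2F 0F (λ ()) | K₃ 2F 1F (λ ()) = refl

twoTree-degreeSum : ∀ {n} {G : Graph n} → IsTwoTree G → sum (deg G) + 6 ≡ 4 * n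
twoTree-degreeSum (base G K₃) = cong (_+ 6) (trans (sum-cong-≗ (triangle-deg {G} K₃)) (sum-const 3 2))
twoTree-degreeSum {suc n} (step G w u v T u~v only w~u w~v) = begin
  sum (deg G) + 6                   ≡⟨ cong (_+ 6) (degreeSum-deleteVertex G w) ⟩
  2 * deg G w + sum (deg G-w) + 6   ≡⟨ cong (λ d → 2 * d + sum (deg G-w) + 6) deg-w≡2 ⟩
  4 + sum (deg G-w) + 6             ≡⟨ +-assoc 4 (sum (deg G-w)) 6 ⟩
  4 + (sum (deg G-w) + 6)           ≡⟨ cong (4 +_) (twoTree-degreeSum T) ⟩
  4 + 4 * n                         ≡⟨ *-suc 4 n ⟨
  4 * suc n                         ∎
  where
  open ≡-Reasoning
  G-w = deleteVertex G w
  N⊆uv : ∀ {j} → adj G w j ≡ true → j ∈ punchIn w u ∷ punchIn w v ∷ []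
  N⊆uv {j} w~j with punchView w j
  ... | at         = ⊥-elim (adjacent⇒≢ G w~j refl)
  ... | punched j′ = [ here ∘ cong (punchIn w) , there ∘ here ∘ cong (punchIn w) ]′ (only j′ w~j)
  deg-w≡2 : deg G w ≡ 2
  deg-w≡2 = ≤-antisym (deg≤length G N⊆uv) (length≤deg G distinct (w~u ∷ w~v ∷ []))
    where
    distinct : Unique (punchIn w u ∷ punchIn w v ∷ [])
    distinct = ((adjacent⇒≢ G-w u~v ∘ punchIn-injective w u v) ∷ []) ∷ [] ∷ []

-- Graphs with a labelled adjacency pattern

module _ {n : ℕ} where

  transpose-sends : ∀ (i j : Fin n) → Perm.transpose i j ⟨$⟩ʳ i ≡ j
  transpose-sends i j rewrite dec-true (i ≟ i) refl = refl

  transpose-fixes : ∀ {i j k : Fin n} → k ≢ i → k ≢ j → Perm.transpose i j ⟨$⟩ʳ k ≡ k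
  transpose-fixes {i} {j} {k} k≢i k≢j rewrite dec-false (k ≟ i) k≢i | dec-false (k ≟ j) k≢j = refl

  permutation-injective : ∀ (π : Permutation′ n) {i j} → π ⟨$⟩ʳ i ≡ π ⟨$⟩ʳ j → i ≡ j
  permutation-injective π = Injection.injective (↔⇒↣ π)

permutation-extending : ∀ {k n} (s t : Fin k → Fin n) →
  Injective _≡_ _≡_ s → Injective _≡_ _≡_ t →
  Σ (Permutation′ n) λ π → ∀ m → π ⟨$⟩ʳ s m ≡ t m
permutation-extending {zero} s t _ _ = Perm.id , λ ()
permutation-extending {suc k} s t s-inj t-inj =
  let π , πs≡t = permutation-extending (s ∘ suc) (t ∘ suc) (suc-injective ∘ s-inj)
                                                          (suc-injective ∘ t-inj)
      τ = Perm.transpose (π ⟨$⟩ʳ s 0F) (t 0F)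
      t≢πs₀ : ∀ m → t (suc m) ≢ π ⟨$⟩ʳ s 0F
      t≢πs₀ m t≡πs₀ =
        0≢1+n (s-inj (permutation-injective π (trans (sym t≡πs₀) (sym (πs≡t m)))))
  in π Perm.∘ₚ τ , λ where
       zero    → transpose-sends (π ⟨$⟩ʳ s 0F) (t 0F)
       (suc m) → trans (cong (τ ⟨$⟩ʳ_) (πs≡t m))
                       (transpose-fixes (t≢πs₀ m) (0≢1+n ∘ t-inj ∘ sym))

module _ {k n : ℕ} (s : Fin k → Fin n) where

  label : Fin n → Maybe (Fin k)
  label i with any? (λ m → s m ≟ i)
  ... | yes (m , _) = just m
  ... | no _        = nothing

  label-distinguished : Injective _≡_ _≡_ s → ∀ m → label (s m) ≡ just m
  label-distinguished s-inj m with any? (λ m′ → s m′ ≟ s m)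
  ... | yes (m′ , sm′≡sm) = cong just (s-inj sm′≡sm)
  ... | no ∄              = contradiction (m , refl) ∄

  label-other : ∀ {i} → (∀ m → i ≢ s m) → label i ≡ nothing
  label-other {i} i∉s with any? (λ m → s m ≟ i)
  ... | yes (m , sm≡i) = contradiction (sym sm≡i) (i∉s m)
  ... | no _           = refl

  data LabelView : Fin n → Maybe (Fin k) → Set where
    labelled   : ∀ m → LabelView (s m) (just m)
    unlabelled : ∀ {i} → (∀ m → i ≢ s m) → LabelView i nothing

  labelView : ∀ i → LabelView i (label i)
  labelView i with any? (λ m → s m ≟ i)
  ... | yes (m , refl) = labelled m
  ... | no ∄           = unlabelled λ m i≡sm → ∄ (m , sym i≡sm)

label-permute : ∀ {k n} {s t : Fin k → Fin n} (π : Permutation′ n) →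
  (∀ m → π ⟨$⟩ʳ s m ≡ t m) → Injective _≡_ _≡_ t →
  ∀ i → label t (π ⟨$⟩ʳ i) ≡ label s i
label-permute {s = s} {t} π πs≡t t-inj i with label s i | labelView s i
... | _ | labelled m       = trans (cong (label t) (πs≡t m)) (label-distinguished t t-inj m)
... | _ | unlabelled i∉s  =
  label-other t λ m πi≡tm → i∉s m (permutation-injective π (trans πi≡tm (sym (πs≡t m))))

Pattern : ℕ → Set
Pattern k = Maybe (Fin k) → Maybe (Fin k) → Bool

record Realises {n k : ℕ} (M : Pattern k) (G : Graph n) : Set where
  field
    distinguished           : Fin k → Fin n
    distinguished-injective : Injective _≡_ _≡_ distinguished
    adj≡pattern             : ∀ i j → adj G i j ≡ M (label distinguished i) (label distinguished j)

realisations-isomorphic : ∀ {n k} {M : Pattern k} {G H : Graph n} →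
  Realises M G → Realises M H → Isomorphic G H
realisations-isomorphic {n} {k} {M} {G} {H} RG RH
  with π , πs≡t ← permutation-extending _ _ (Realises.distinguished-injective RG)
                                             (Realises.distinguished-injective RH) =
  π , λ i j → begin
    adj H (π ⟨$⟩ʳ i) (π ⟨$⟩ʳ j)                   ≡⟨ adj≡pattern RH _ _ ⟩
    M (label t (π ⟨$⟩ʳ i)) (label t (π ⟨$⟩ʳ j))   ≡⟨ cong₂ M (relabel i) (relabel j) ⟩
    M (label s i) (label s j)                    ≡⟨ adj≡pattern RG i j ⟨
    adj G i j                                    ∎
  where
  open ≡-Reasoning
  open Realises
  s t : Fin k → Fin n
  s = distinguished RG
  t = distinguished RH
  relabel : ∀ i → label t (π ⟨$⟩ʳ i) ≡ label s i
  relabel = label-permute π πs≡t (distinguished-injective RH)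

-- Good graphs

module _ {n : ℕ} {G : Graph n} {Δ : ℕ} where

  tail3? : ∀ i → Dec (¬ deg G i ≡ Δ × deg G i ≡ 3)
  tail3? i = ¬? (deg G i ℕ.≟ Δ) ×-dec (deg G i ℕ.≟ 3)

  deg-split : 2 ≤ Δ → TailSet23 G Δ →
    ∀ i → deg G i ≡ 2 + ((Δ ∸ 2) * bit (does (deg G i ℕ.≟ Δ)) + bit (does (tail3? i)))
  deg-split 2≤Δ tail i = split (deg G i ℕ.≟ Δ) (deg G i ℕ.≟ 3) (tail i)
    where
    split : ∀ {d} (d≟Δ : Dec (d ≡ Δ)) (d≟3 : Dec (d ≡ 3)) →
            (¬ d ≡ Δ → d ≡ 2 ⊎ d ≡ 3) →
            d ≡ 2 + ((Δ ∸ 2) * bit (does d≟Δ) + bit (does (¬? d≟Δ ×-dec d≟3)))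
    split (yes refl) _ _ =
      sym (trans (cong (2 +_) (trans (+-identityʳ _) (*-identityʳ (Δ ∸ 2)))) (m+[n∸m]≡n 2≤Δ))
    split (no _) (yes refl) _ = cong (λ k → 2 + (k + 1)) (sym (*-zeroʳ (Δ ∸ 2)))
    split (no d≢Δ) (no d≢3) tail-d with tail-d d≢Δ
    ... | inj₁ refl = cong (λ k → 2 + (k + 0)) (sym (*-zeroʳ (Δ ∸ 2)))
    ... | inj₂ d≡3  = contradiction d≡3 d≢3

  good-degreeSum : 2 ≤ Δ → TailSet23 G Δ → countV (λ i → deg G i ℕ.≟ Δ) ≡ 2 →
    tail3Count G Δ ≡ 2 → sum (deg G) ≡ n * 2 + ((Δ ∸ 2) * 2 + 2)
  good-degreeSum 2≤Δ tail core≡2 tail3≡2 = begin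
    sum (deg G)
      ≡⟨ sum-cong-≗ (deg-split 2≤Δ tail) ⟩
    sum (λ i → 2 + excess i)
      ≡⟨ ∑-distrib-+ (λ _ → 2) excess ⟩
    sum {n} (λ _ → 2) + sum excess
      ≡⟨ cong₂ _+_ (sum-const n 2) (∑-distrib-+ extra t3) ⟩
    n * 2 + (sum extra + sum t3)
      ≡⟨ cong (λ k → n * 2 + (k + sum t3)) (*-distribˡ-sum (Δ ∸ 2) core) ⟨
    n * 2 + ((Δ ∸ 2) * sum core + sum t3)
      ≡⟨ cong₂ (λ c t → n * 2 + ((Δ ∸ 2) * c + t)) core-sum t3-sum ⟩
    n * 2 + ((Δ ∸ 2) * 2 + 2)
      ∎
    where
    open ≡-Reasoning
    core t3 extra excess : Fin n → ℕ
    core   i = bit (does (deg G i ℕ.≟ Δ))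
    t3     i = bit (does (tail3? i))
    extra  i = (Δ ∸ 2) * core i
    excess i = extra i + t3 i
    core-sum : sum core ≡ 2
    core-sum = trans (sym (countV≡sum (λ i → deg G i ℕ.≟ Δ))) core≡2
    t3-sum : sum t3 ≡ 2
    t3-sum = trans (sym (countV≡sum tail3?)) tail3≡2

  core-degree : IsTwoTree G → 2 ≤ Δ → TailSet23 G Δ → countV (λ i → deg G i ℕ.≟ Δ) ≡ 2 →
    tail3Count G Δ ≡ 2 → Δ + 2 ≡ n
  core-degree T 2≤Δ tail core≡2 tail3≡2 = trans (cong (_+ 2) (sym (m+[n∸m]≡n 2≤Δ)))
    (cancel n (Δ ∸ 2) (trans (cong (_+ 6) (sym (good-degreeSum 2≤Δ tail core≡2 tail3≡2)))
                             (twoTree-degreeSum T)))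
    where
    open ≡-Reasoning
    regroup : ∀ n k → n * 2 + (2 + k + 2) * 2 ≡ n * 2 + (k * 2 + 2) + 6
    regroup = solve-∀
    double : ∀ n → 4 * n ≡ n * 2 + n * 2
    double = solve-∀
    cancel : ∀ n k → n * 2 + (k * 2 + 2) + 6 ≡ 4 * n → 2 + k + 2 ≡ n
    cancel n k eq = *-cancelʳ-≡ (2 + k + 2) n 2 (+-cancelˡ-≡ (n * 2) _ _ (begin
      n * 2 + (2 + k + 2) * 2   ≡⟨ regroup n k ⟩
      n * 2 + (k * 2 + 2) + 6   ≡⟨ eq ⟩
      4 * n                     ≡⟨ double n ⟩
      n * 2 + n * 2             ∎))

record CoreAndTail {n : ℕ} (G : Graph n) : Set where
  field
    twoTree  : IsTwoTree G
    u v      : Fin n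
    u~v      : adj G u v ≡ true
    x        : Fin n
    x≢u      : x ≢ u
    u≁x      : adj G u x ≡ false
    u~       : ∀ j → j ≢ u → j ≢ x → adj G u j ≡ true
    y        : Fin n
    y≢v      : y ≢ v
    v≁y      : adj G v y ≡ false
    v~       : ∀ j → j ≢ v → j ≢ y → adj G v j ≡ true
    t₁ t₂    : Fin n
    tail-deg : ∀ z → z ≢ u → z ≢ v → deg G z ≡ 2 ⊎ deg G z ≡ 3 × (z ≡ t₁ ⊎ z ≡ t₂)

good⇒coreAndTail : ∀ {n} {G : Graph n} → IsGoodGraph G → CoreAndTail G
good⇒coreAndTail {n} {G} (T , Δ , (2≤Δ , _ , core≡2) , strong , tail , tail3≡2)
  with Δ+2≡n ← core-degree T 2≤Δ tail core≡2 tail3≡2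
  with u , v , u≢v , deg-u , deg-v , core-only ← countV≡2⇒pair (λ i → deg G i ℕ.≟ Δ) core≡2
  with t₁ , t₂ , _ , _ , _ , tail3-only ← countV≡2⇒pair (tail3? {G = G} {Δ}) tail3≡2
  with x , x≢u , u≁x , u~ ← non-neighbour-unique G u (trans (cong (_+ 2) deg-u) Δ+2≡n)
  with y , y≢v , v≁y , v~ ← non-neighbour-unique G v (trans (cong (_+ 2) deg-v) Δ+2≡n) = record
  { twoTree  = T
  ; u = u ; v = v ; u~v = strong u v deg-u deg-v u≢v
  ; x = x ; x≢u = x≢u ; u≁x = u≁x ; u~ = u~
  ; y = y ; y≢v = y≢v ; v≁y = v≁y ; v~ = v~
  ; t₁ = t₁ ; t₂ = t₂
  ; tail-deg = λ z z≢u z≢v → let non-core = [ z≢u , z≢v ]′ ∘ core-only in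
      Sum.map₂ (λ deg≡3 → deg≡3 , tail3-only (non-core , deg≡3)) (tail z non-core)
  }

swapCore : ∀ {n} {G : Graph n} → CoreAndTail G → CoreAndTail G
swapCore {G = G} F = record
  { twoTree = twoTree
  ; u = v ; v = u ; u~v = adj-flip G u~v
  ; x = y ; x≢u = y≢v ; u≁x = v≁y ; u~ = v~
  ; y = x ; y≢v = x≢u ; v≁y = u≁x ; v~ = u~
  ; t₁ = t₁ ; t₂ = t₂
  ; tail-deg = λ z z≢v z≢u → tail-deg z z≢u z≢v
  }
  where open CoreAndTail F

module _ {n : ℕ} {G : Graph n} (F : CoreAndTail G) where
  open CoreAndTail F

  u≢v : u ≢ v
  u≢v = adjacent⇒≢ G u~v

  x≢v : x ≢ v
  x≢v = neighbour≢non-neighbour G u~v u≁x ∘ sym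

  y≢u : y ≢ u
  y≢u = neighbour≢non-neighbour G (adj-flip G u~v) v≁y ∘ sym

  ~u : ∀ {j} → j ≢ u → j ≢ x → adj G j u ≡ true
  ~u j≢u j≢x = adj-flip G (u~ _ j≢u j≢x)

  ~v : ∀ {j} → j ≢ v → j ≢ y → adj G j v ≡ true
  ~v j≢v j≢y = adj-flip G (v~ _ j≢v j≢y)

  tail-triple : ∀ {z a} → z ≢ u → z ≢ v → a ≢ u → a ≢ v →
    adj G z u ≡ true → adj G z v ≡ true → adj G z a ≡ true →
    (z ≡ t₁ ⊎ z ≡ t₂) × (∀ {r} → adj G z r ≡ true → r ∈ u ∷ v ∷ a ∷ [])
  tail-triple {z} {a} z≢u z≢v a≢u a≢v z~u z~v z~a = case tail-deg z z≢u z≢v of λ where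
      (inj₁ deg≡2) →
        contradiction (subst (3 ≤_) deg≡2 (length≤deg G distinct z~uva)) λ where (s≤s (s≤s ()))
      (inj₂ (deg≡3 , z∈t)) →
        z∈t , λ {r} → deg≤length⇒neighbour∈ G distinct z~uva (≤-reflexive deg≡3)
    where
    distinct : Unique (u ∷ v ∷ a ∷ [])
    distinct = (u≢v ∷ (a≢u ∘ sym) ∷ []) ∷ ((a≢v ∘ sym) ∷ []) ∷ [] ∷ []
    z~uva : All (λ r → adj G z r ≡ true) (u ∷ v ∷ a ∷ [])
    z~uva = z~u ∷ z~v ∷ z~a ∷ []

  x-neighbour : ∀ {s} → adj G x s ≡ true → adj G s v ≡ true →
    (s ≡ t₁ ⊎ s ≡ t₂) × (∀ {r} → adj G s r ≡ true → r ∈ u ∷ v ∷ x ∷ [])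
  x-neighbour {s} x~s s~v =
    tail-triple s≢u (adjacent⇒≢ G s~v) x≢u x≢v (~u s≢u (adjacent⇒≢ G x~s ∘ sym)) s~v
                (adj-flip G x~s)
    where
    s≢u : s ≢ u
    s≢u = neighbour≢non-neighbour G x~s (adj-flip G u≁x)

  x≢y : x ≢ y
  x≢y x≡y = absurd (twoTree-minDegree twoTree x)
    where
    v≁x : adj G v x ≡ false
    v≁x = subst (λ k → adj G v k ≡ false) (sym x≡y) v≁y
    non-hub : ∀ {s} → adj G x s ≡ true → All (s ≢_) (u ∷ v ∷ x ∷ [])
    non-hub x~s = neighbour≢non-neighbour G x~s (adj-flip G u≁x)
                ∷ neighbour≢non-neighbour G x~s (adj-flip G v≁x)
                ∷ (adjacent⇒≢ G x~s ∘ sym) ∷ []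
    nbr : ∀ {s} → adj G x s ≡ true →
          (s ≡ t₁ ⊎ s ≡ t₂) × (∀ {r} → adj G s r ≡ true → r ∈ u ∷ v ∷ x ∷ [])
    nbr x~s with _ ∷ s≢v ∷ s≢x ∷ [] ← non-hub x~s =
      x-neighbour x~s (~v s≢v λ s≡y → s≢x (trans s≡y (sym x≡y)))
    absurd : (∃₂ λ s t → s ≢ t × adj G x s ≡ true × adj G x t ≡ true) → ⊥
    absurd (s , t , s≢t , x~s , x~t) with tail-deg x x≢u x≢v
    ... | inj₁ deg≡2     =
      All¬⇒¬Any (non-hub x~t) (proj₂ (nbr x~s) (twoTree-deg≡2⇒link twoTree deg≡2 s≢t x~s x~t))
    ... | inj₂ (_ , x∈t) = [ adjacent⇒≢ G x~s , adjacent⇒≢ G x~t ]′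
                             (pair-covered s≢t (proj₁ (nbr x~s)) (proj₁ (nbr x~t)) x∈t)

  x~v : adj G x v ≡ true
  x~v = ~v x≢v x≢y

  x≁y : adj G x y ≡ false
  x≁y = ¬-not absurd
    where
    absurd : adj G x y ≡ true → ⊥
    absurd x~y with tail-deg x x≢u x≢v | tail-deg y y≢u y≢v
    ... | inj₁ deg≡2 | _ =
      neighbour≢non-neighbour G (twoTree-deg≡2⇒link twoTree deg≡2 (y≢v ∘ sym) x~v x~y) v≁y refl
    ... | inj₂ _ | inj₁ deg≡2 =
      neighbour≢non-neighbour G (twoTree-deg≡2⇒link twoTree deg≡2 (x≢u ∘ sym) y~u y~x) u≁x refl
      where
      y~u : adj G y u ≡ true
      y~u = ~u y≢u (x≢y ∘ sym)
      y~x : adj G y x ≡ true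
      y~x = adj-flip G x~y
    ... | inj₂ (deg≡3 , x∈t) | inj₂ (_ , y∈t)
      with r , x~r , r∉vy ← length<deg⇒∃neighbour∉ G (v ∷ y ∷ []) (≤-reflexive (sym deg≡3)) =
      [ adjacent⇒≢ G x~r ∘ sym , r∉vy ∘ there ∘ here ]′ (pair-covered x≢y x∈t y∈t r∈t)
      where
      r∈t : r ≡ t₁ ⊎ r ≡ t₂
      r∈t = proj₁ (x-neighbour x~r (~v (r∉vy ∘ here) (r∉vy ∘ there ∘ here)))

  record Attachment : Set where
    field
      p       : Fin n
      p≢u     : p ≢ u
      p≢v     : p ≢ v
      p≢x     : p ≢ x
      p≢y     : p ≢ y
      x~p     : adj G x p ≡ true
      p-tail3 : p ≡ t₁ ⊎ p ≡ t₂
      p-only  : ∀ {r} → adj G p r ≡ true → r ∈ u ∷ v ∷ x ∷ []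

  attachment : Attachment
  attachment with p , x~p , p∉[v] ← length<deg⇒∃neighbour∉ G [ v ] (twoTree-deg≥2 twoTree x) =
    record
      { p = p ; p≢u = p≢u ; p≢v = p∉[v] ∘ here ; p≢x = adjacent⇒≢ G x~p ∘ sym ; p≢y = p≢y
      ; x~p = x~p ; p-tail3 = proj₁ p-facts ; p-only = proj₂ p-facts
      }
    where
    p≢u : p ≢ u
    p≢u = neighbour≢non-neighbour G x~p (adj-flip G u≁x)
    p≢y : p ≢ y
    p≢y = neighbour≢non-neighbour G x~p x≁y
    p-facts : (p ≡ t₁ ⊎ p ≡ t₂) × (∀ {r} → adj G p r ≡ true → r ∈ u ∷ v ∷ x ∷ [])
    p-facts = x-neighbour x~p (~v (p∉[v] ∘ here) p≢y)

-- Rows and columns: u, v, x, y, p, q, then every other vertex.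
bicentralMatrix : Vec (Vec Bool 7) 7
bicentralMatrix =
  (false ∷ true  ∷ false ∷ true  ∷ true  ∷ true  ∷ true  ∷ []) ∷
  (true  ∷ false ∷ true  ∷ false ∷ true  ∷ true  ∷ true  ∷ []) ∷
  (false ∷ true  ∷ false ∷ false ∷ true  ∷ false ∷ false ∷ []) ∷
  (true  ∷ false ∷ false ∷ false ∷ false ∷ true  ∷ false ∷ []) ∷
  (true  ∷ true  ∷ true  ∷ false ∷ false ∷ false ∷ false ∷ []) ∷
  (true  ∷ true  ∷ false ∷ true  ∷ false ∷ false ∷ false ∷ []) ∷
  (true  ∷ true  ∷ false ∷ false ∷ false ∷ false ∷ false ∷ []) ∷ []

bicentralPattern : Pattern 6
bicentralPattern l l′ = Vec.lookup (Vec.lookup bicentralMatrix (index l)) (index l′)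
  where
  index : Maybe (Fin 6) → Fin 7
  index = maybe inject₁ (fromℕ 6)

module _ {n : ℕ} {G : Graph n} (F : CoreAndTail G) where
  open CoreAndTail F
  open Attachment (attachment F)
  open Attachment (attachment (swapCore F)) using () renaming
    ( p to q; p≢u to q≢v; p≢v to q≢u; p≢x to q≢y; p≢y to q≢x; x~p to y~q
    ; p-tail3 to q-tail3; p-only to q-only)

  p≢q : p ≢ q
  p≢q p≡q = All¬⇒¬Any (y≢u F ∷ y≢v ∷ (x≢y F ∘ sym) ∷ [])
                      (p-only (subst (λ k → adj G k y ≡ true) (sym p≡q) (adj-flip G y~q)))

  deg≡2 : ∀ {z} → z ≢ u → z ≢ v → z ≢ p → z ≢ q → deg G z ≡ 2
  deg≡2 {z} z≢u z≢v z≢p z≢q = [ id , ⊥-elim ∘ z∉pq ∘ proj₂ ]′ (tail-deg z z≢u z≢v)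
    where
    z∉pq : ¬ (z ≡ t₁ ⊎ z ≡ t₂)
    z∉pq = [ z≢p , z≢q ]′ ∘ pair-covered p≢q p-tail3 q-tail3

  x≁ : ∀ {j} → All (j ≢_) (v ∷ p ∷ []) → adj G x j ≡ false
  x≁ = outside⇒non-adjacent G (deg≡2⇒neighbour∈ G deg-x≡2 (p≢v ∘ sym) (x~v F) x~p)
    where
    deg-x≡2 : deg G x ≡ 2
    deg-x≡2 = deg≡2 x≢u (x≢v F) (p≢x ∘ sym) (q≢x ∘ sym)

  y≁ : ∀ {j} → All (j ≢_) (u ∷ q ∷ []) → adj G y j ≡ false
  y≁ = outside⇒non-adjacent G (deg≡2⇒neighbour∈ G deg-y≡2 (q≢u ∘ sym) (x~v (swapCore F)) y~q)
    where
    deg-y≡2 : deg G y ≡ 2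
    deg-y≡2 = deg≡2 (y≢u F) y≢v (p≢y ∘ sym) (q≢y ∘ sym)

  p≁ : ∀ {j} → All (j ≢_) (u ∷ v ∷ x ∷ []) → adj G p j ≡ false
  p≁ = outside⇒non-adjacent G p-only

  q≁ : ∀ {j} → All (j ≢_) (v ∷ u ∷ y ∷ []) → adj G q j ≡ false
  q≁ = outside⇒non-adjacent G q-only

  bicentral-vertices : Fin 6 → Fin n
  bicentral-vertices = Vec.lookup (u ∷ v ∷ x ∷ y ∷ p ∷ q ∷ [])

  rest≁ : ∀ {i j} → (∀ m → i ≢ bicentral-vertices m) → All (j ≢_) (u ∷ v ∷ []) →
          adj G i j ≡ false
  rest≁ {i} i∉ = outside⇒non-adjacent G (deg≡2⇒neighbour∈ G deg-i≡2 (u≢v F) i~u i~v)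
    where
    deg-i≡2 : deg G i ≡ 2
    deg-i≡2 = deg≡2 (i∉ 0F) (i∉ 1F) (i∉ 4F) (i∉ 5F)
    i~u : adj G i u ≡ true
    i~u = ~u F (i∉ 0F) (i∉ 2F)
    i~v : adj G i v ≡ true
    i~v = ~v F (i∉ 1F) (i∉ 3F)

  bicentral-vertices-injective : Injective _≡_ _≡_ bicentral-vertices
  bicentral-vertices-injective = lookup-injective distinct _ _
    where
    distinct : VecUnique (u ∷ v ∷ x ∷ y ∷ p ∷ q ∷ [])
    distinct = (u≢v F ∷ (x≢u ∘ sym) ∷ (y≢u F ∘ sym) ∷ (p≢u ∘ sym) ∷ (q≢u ∘ sym) ∷ [])
             ∷ ((x≢v F ∘ sym) ∷ (y≢v ∘ sym) ∷ (p≢v ∘ sym) ∷ (q≢v ∘ sym) ∷ [])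
             ∷ (x≢y F ∷ (p≢x ∘ sym) ∷ (q≢x ∘ sym) ∷ [])
             ∷ ((p≢y ∘ sym) ∷ (q≢y ∘ sym) ∷ [])
             ∷ (p≢q ∷ [])
             ∷ [] ∷ []

  bicentral-adj : ∀ {i j li lj} → LabelView bicentral-vertices i li →
                  LabelView bicentral-vertices j lj → adj G i j ≡ bicentralPattern li lj
  bicentral-adj (labelled 0F)   (labelled 0F)   = irrfl G u
  bicentral-adj (labelled 0F)   (labelled 1F)   = u~v
  bicentral-adj (labelled 0F)   (labelled 2F)   = u≁x
  bicentral-adj (labelled 0F)   (labelled 3F)   = u~ y (y≢u F) (x≢y F ∘ sym)
  bicentral-adj (labelled 0F)   (labelled 4F)   = u~ p p≢u p≢x
  bicentral-adj (labelled 0F)   (labelled 5F)   = u~ q q≢u q≢x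
  bicentral-adj (labelled 0F)   (unlabelled j∉) = u~ _ (j∉ 0F) (j∉ 2F)
  bicentral-adj (labelled 1F)   (labelled 0F)   = adj-flip G u~v
  bicentral-adj (labelled 1F)   (labelled 1F)   = irrfl G v
  bicentral-adj (labelled 1F)   (labelled 2F)   = v~ x (x≢v F) (x≢y F)
  bicentral-adj (labelled 1F)   (labelled 3F)   = v≁y
  bicentral-adj (labelled 1F)   (labelled 4F)   = v~ p p≢v p≢y
  bicentral-adj (labelled 1F)   (labelled 5F)   = v~ q q≢v q≢y
  bicentral-adj (labelled 1F)   (unlabelled j∉) = v~ _ (j∉ 1F) (j∉ 3F)
  bicentral-adj (labelled 2F)   (labelled 0F)   = adj-flip G u≁x
  bicentral-adj (labelled 2F)   (labelled 1F)   = x~v F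
  bicentral-adj (labelled 2F)   (labelled 2F)   = irrfl G x
  bicentral-adj (labelled 2F)   (labelled 3F)   = x≁y F
  bicentral-adj (labelled 2F)   (labelled 4F)   = x~p
  bicentral-adj (labelled 2F)   (labelled 5F)   = x≁ (q≢v ∷ (p≢q ∘ sym) ∷ [])
  bicentral-adj (labelled 2F)   (unlabelled j∉) = x≁ (j∉ 1F ∷ j∉ 4F ∷ [])
  bicentral-adj (labelled 3F)   (labelled 0F)   = x~v (swapCore F)
  bicentral-adj (labelled 3F)   (labelled 1F)   = adj-flip G v≁y
  bicentral-adj (labelled 3F)   (labelled 2F)   = adj-flip G (x≁y F)
  bicentral-adj (labelled 3F)   (labelled 3F)   = irrfl G y
  bicentral-adj (labelled 3F)   (labelled 4F)   = y≁ (p≢u ∷ p≢q ∷ [])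
  bicentral-adj (labelled 3F)   (labelled 5F)   = y~q
  bicentral-adj (labelled 3F)   (unlabelled j∉) = y≁ (j∉ 0F ∷ j∉ 5F ∷ [])
  bicentral-adj (labelled 4F)   (labelled 0F)   = ~u F p≢u p≢x
  bicentral-adj (labelled 4F)   (labelled 1F)   = ~v F p≢v p≢y
  bicentral-adj (labelled 4F)   (labelled 2F)   = adj-flip G x~p
  bicentral-adj (labelled 4F)   (labelled 3F)   = p≁ (y≢u F ∷ y≢v ∷ (x≢y F ∘ sym) ∷ [])
  bicentral-adj (labelled 4F)   (labelled 4F)   = irrfl G p
  bicentral-adj (labelled 4F)   (labelled 5F)   = p≁ (q≢u ∷ q≢v ∷ q≢x ∷ [])
  bicentral-adj (labelled 4F)   (unlabelled j∉) = p≁ (j∉ 0F ∷ j∉ 1F ∷ j∉ 2F ∷ [])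
  bicentral-adj (labelled 5F)   (labelled 0F)   = ~u F q≢u q≢x
  bicentral-adj (labelled 5F)   (labelled 1F)   = ~v F q≢v q≢y
  bicentral-adj (labelled 5F)   (labelled 2F)   = q≁ (x≢v F ∷ x≢u ∷ x≢y F ∷ [])
  bicentral-adj (labelled 5F)   (labelled 3F)   = adj-flip G y~q
  bicentral-adj (labelled 5F)   (labelled 4F)   = q≁ (p≢v ∷ p≢u ∷ p≢y ∷ [])
  bicentral-adj (labelled 5F)   (labelled 5F)   = irrfl G q
  bicentral-adj (labelled 5F)   (unlabelled j∉) = q≁ (j∉ 1F ∷ j∉ 0F ∷ j∉ 3F ∷ [])
  bicentral-adj (unlabelled i∉) (labelled 0F)   = ~u F (i∉ 0F) (i∉ 2F)
  bicentral-adj (unlabelled i∉) (labelled 1F)   = ~v F (i∉ 1F) (i∉ 3F)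
  bicentral-adj (unlabelled i∉) (labelled 2F)   = rest≁ i∉ (x≢u ∷ x≢v F ∷ [])
  bicentral-adj (unlabelled i∉) (labelled 3F)   = rest≁ i∉ (y≢u F ∷ y≢v ∷ [])
  bicentral-adj (unlabelled i∉) (labelled 4F)   = rest≁ i∉ (p≢u ∷ p≢v ∷ [])
  bicentral-adj (unlabelled i∉) (labelled 5F)   = rest≁ i∉ (q≢u ∷ q≢v ∷ [])
  bicentral-adj (unlabelled i∉) (unlabelled j∉) = rest≁ i∉ (j∉ 0F ∷ j∉ 1F ∷ [])

  coreAndTail⇒realises : Realises bicentralPattern G
  coreAndTail⇒realises = record
    { distinguished           = bicentral-vertices
    ; distinguished-injective = bicentral-vertices-injective
    ; adj≡pattern             = λ i j → bicentral-adj (labelView _ i) (labelView _ j)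
    }

theorem4p8 : (n : ℕ) → 6 ≤ n → (G H : Graph n) →
    IsGoodGraph G → IsGoodGraph H → Isomorphic G H
theorem4p8 n _ G H good-G good-H = realisations-isomorphic
  (coreAndTail⇒realises (good⇒coreAndTail good-G))
  (coreAndTail⇒realises (good⇒coreAndTail good-H))
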